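{- For all integers $s\ge r\ge 2$, the complete $r$-graph $K^r_{s+1}$ is not $(r-1)$-shadow-homomorphic to $K^r_s$.
   Context: An $r$-graph is an $r$-uniform hypergraph; $K^r_s$ is the complete $r$-graph on $s$ vertices. For an $r$-graph $H$, $\partial_k H=\bigcup_{e\in E(H)}\binom{e}{k}$ is its $k$-shadow. An $r$-graph $A$ is $k$-shadow-homomorphic to an $r$-graph $B$ if one can choose for each $S\in\partial_k A$ a set $f(S)\in\partial_k B$ and a bijection $g_S:S\to f(S)$ such that for every edge $e\in E(A)$ there exist an edge $e'\in E(B)$ and a bijection $g:e\to e'$ with $g|_S=g_S$ for every $S\in\binom{e}{k}$. -}

module Defs where

open import Data.Nat using (ℕ)
open import Data.Fin using (Fin)
open import Data.Fin.Subset using (Subset; _∈_; _⊆_; ∣_∣)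
open import Data.Product using (Σ; _×_; ∃; ∃-syntax)
open import Relation.Binary.PropositionalEquality using (_≡_)

record RGraph (r : ℕ) : Set₁ where
  field
    n       : ℕ
    Edge    : Subset n → Set
    uniform : ∀ e → Edge e → ∣ e ∣ ≡ r
open RGraph public

K : (r s : ℕ) → RGraph r
K r s = record { n = s ; Edge = λ e → ∣ e ∣ ≡ r ; uniform = λ e p → p }

InShadow : ∀ {r} (k : ℕ) (H : RGraph r) → Subset (n H) → Set
InShadow k H S = ∣ S ∣ ≡ k × (∃[ e ] (Edge H e × S ⊆ e))

BijOn : ∀ {a b} → Subset a → Subset b → (Fin a → Fin b) → Set
BijOn S T φ =
    (∀ {x} → x ∈ S → φ x ∈ T)
  × (∀ {x y} → x ∈ S → y ∈ S → φ x ≡ φ y → x ≡ y)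
  × (∀ {y} → y ∈ T → ∃[ x ] (x ∈ S × φ x ≡ y))

AgreeOn : ∀ {a b} → Subset a → (Fin a → Fin b) → (Fin a → Fin b) → Set
AgreeOn S φ ψ = ∀ {x} → x ∈ S → φ x ≡ ψ x

-- A is k-shadow-homomorphic to B: there are f (choosing f(S) ∈ ∂_k B for each
-- S ∈ ∂_k A) and g (g S restricted to S is the bijection g_S : S → f(S)) such that
-- every edge e of A has an edge e' of B and a bijection g : e → e'
-- extending all g_S for S ∈ binom(e,k).
ShadowHom : ∀ {r} (k : ℕ) (A B : RGraph r) → Set
ShadowHom k A B =
  Σ (Subset (n A) → Subset (n B)) λ f →
  Σ (Subset (n A) → Fin (n A) → Fin (n B)) λ g →
      (∀ S → InShadow k A S → InShadow k B (f S))
    × (∀ S → InShadow k A S → BijOn S (f S) (g S))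
    × (∀ e → Edge A e →
         ∃[ e' ] (Edge B e' × ∃[ φ ] (BijOn e e' φ
           × (∀ S → S ⊆ e → ∣ S ∣ ≡ k → AgreeOn S φ (g S)))))

-- Fix an (r−2)-set T and a vertex x₀ ∉ T of K^r_{s+1}, and give every vertex i the
-- (r−1)-set Sᵢ = {i} ∪ T (or {x₀} ∪ T when i ∈ T), which contains i. Any two of these
-- sets lie in a common edge of K^r_{s+1}, and the bijection attached to that edge
-- extends both g_{Sᵢ} and g_{Sⱼ}; hence i ↦ g_{Sᵢ}(i) is injective, which is
-- impossible from s + 1 vertices into s vertices.
module Submission where

open import Defs
open import Data.Nat using (ℕ; suc; _≤_; _<_; _∸_; z≤n; s≤s)
open import Data.Nat.Properties using (m+n≤o⇒n≤o; m≤n⇒m≤1+n; 1+n≰n)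
open import Data.Fin using (Fin; zero; suc)
open import Data.Fin.Properties using (_≟_; injective⇒≤)
open import Data.Fin.Subset
  using (Subset; _∈_; _∉_; _⊆_; _∪_; ⁅_⁆; ∣_∣; inside; outside; ⊥)
open import Data.Fin.Subset.Properties
  using (_∈?_; ∣⊥∣≡0; x∈⁅x⁆; x∈⁅y⁆⇒x≡y; x∈p∪q⁻; x∈p∪q⁺; q⊆p∪q; ∪-identityˡ)
open import Data.Vec using (_∷_; here; there)
open import Data.Product using (Σ; _×_; _,_; proj₁; proj₂; ∃-syntax)
open import Data.Sum using (inj₁; inj₂)
open import Data.Empty using (⊥-elim)
open import Function using (_∘_)
open import Relation.Nullary using (¬_; yes; no)
open import Relation.Binary.PropositionalEquality
  using (_≡_; refl; sym; trans; cong; subst; module ≡-Reasoning)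

subset-of-size : ∀ {m n} → m ≤ n → Σ (Subset n) λ p → ∣ p ∣ ≡ m
subset-of-size {n = n} z≤n = ⊥ , ∣⊥∣≡0 n
subset-of-size (s≤s m≤n) with p , ∣p∣≡m ← subset-of-size m≤n = inside ∷ p , cong suc ∣p∣≡m

∣p∣<n⇒∃x∉p : ∀ {n} (p : Subset n) → ∣ p ∣ < n → ∃[ x ] x ∉ p
∣p∣<n⇒∃x∉p (outside ∷ p) _ = zero , λ ()
∣p∣<n⇒∃x∉p (inside ∷ p) (s≤s ∣p∣<n) with x , x∉p ← ∣p∣<n⇒∃x∉p p ∣p∣<n =
  suc x , λ { (there x∈p) → x∉p x∈p }

x∉p⇒∣⁅x⁆∪p∣≡1+∣p∣ : ∀ {n} (x : Fin n) (p : Subset n) → x ∉ p → ∣ ⁅ x ⁆ ∪ p ∣ ≡ suc ∣ p ∣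
x∉p⇒∣⁅x⁆∪p∣≡1+∣p∣ zero    (inside  ∷ p) x∉p = ⊥-elim (x∉p here)
x∉p⇒∣⁅x⁆∪p∣≡1+∣p∣ zero    (outside ∷ p) _   = cong (suc ∘ ∣_∣) (∪-identityˡ p)
x∉p⇒∣⁅x⁆∪p∣≡1+∣p∣ (suc x) (inside  ∷ p) x∉p = cong suc (x∉p⇒∣⁅x⁆∪p∣≡1+∣p∣ x p (x∉p ∘ there))
x∉p⇒∣⁅x⁆∪p∣≡1+∣p∣ (suc x) (outside ∷ p) x∉p = x∉p⇒∣⁅x⁆∪p∣≡1+∣p∣ x p (x∉p ∘ there)

∪-monoʳ-⊆ : ∀ {n} (p : Subset n) {q q′ : Subset n} → q ⊆ q′ → p ∪ q ⊆ p ∪ q′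
∪-monoʳ-⊆ p {q} q⊆q′ x∈p∪q with x∈p∪q⁻ p q x∈p∪q
... | inj₁ x∈p = x∈p∪q⁺ (inj₁ x∈p)
... | inj₂ x∈q = x∈p∪q⁺ (inj₂ (q⊆q′ x∈q))

module Sunflower {N : ℕ} (T : Subset N) {x₀ : Fin N} (x₀∉T : x₀ ∉ T) where

  tip : Fin N → Fin N
  tip i with i ∈? T
  ... | yes _ = x₀
  ... | no  _ = i

  tip∉T : ∀ i → tip i ∉ T
  tip∉T i with i ∈? T
  ... | yes _   = x₀∉T
  ... | no  i∉T = i∉T

  petal : Fin N → Subset N
  petal i = ⁅ tip i ⁆ ∪ T

  i∈petal : ∀ i → i ∈ petal i
  i∈petal i with i ∈? T
  ... | yes i∈T = q⊆p∪q ⁅ x₀ ⁆ T i∈T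
  ... | no  _   = x∈p∪q⁺ (inj₁ (x∈⁅x⁆ i))

  ∣petal∣ : ∀ i → ∣ petal i ∣ ≡ suc ∣ T ∣
  ∣petal∣ i = x∉p⇒∣⁅x⁆∪p∣≡1+∣p∣ (tip i) T (tip∉T i)

  petals-in-edge : suc (suc ∣ T ∣) ≤ N → ∀ i j →
    ∃[ e ] (∣ e ∣ ≡ suc (suc ∣ T ∣) × petal i ⊆ e × petal j ⊆ e)
  petals-in-edge T+2≤N i j with tip i ≟ tip j
  ... | yes tipᵢ≡tipⱼ with y , y∉petalᵢ ← ∣p∣<n⇒∃x∉p (petal i) (subst (_< N) (sym (∣petal∣ i)) T+2≤N) =
    ⁅ y ⁆ ∪ petal i ,
    trans (x∉p⇒∣⁅x⁆∪p∣≡1+∣p∣ y (petal i) y∉petalᵢ) (cong suc (∣petal∣ i)) ,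
    q⊆p∪q ⁅ y ⁆ (petal i) ,
    subst (_⊆ ⁅ y ⁆ ∪ petal i) (cong (λ a → ⁅ a ⁆ ∪ T) tipᵢ≡tipⱼ) (q⊆p∪q ⁅ y ⁆ (petal i))
  ... | no tipᵢ≢tipⱼ =
    ⁅ tip i ⁆ ∪ petal j ,
    trans (x∉p⇒∣⁅x⁆∪p∣≡1+∣p∣ (tip i) (petal j) tipᵢ∉petalⱼ) (cong suc (∣petal∣ j)) ,
    ∪-monoʳ-⊆ ⁅ tip i ⁆ (q⊆p∪q ⁅ tip j ⁆ T) ,
    q⊆p∪q ⁅ tip i ⁆ (petal j)
    where
    tipᵢ∉petalⱼ : tip i ∉ petal j
    tipᵢ∉petalⱼ tipᵢ∈petalⱼ with x∈p∪q⁻ ⁅ tip j ⁆ T tipᵢ∈petalⱼ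
    ... | inj₁ tipᵢ∈⁅tipⱼ⁆ = tipᵢ≢tipⱼ (x∈⁅y⁆⇒x≡y (tip j) tipᵢ∈⁅tipⱼ⁆)
    ... | inj₂ tipᵢ∈T      = tip∉T i tipᵢ∈T

module ShadowHomProperties {r k} (A B : RGraph r) (hom : ShadowHom k A B) where

  g : Subset (n A) → Fin (n A) → Fin (n B)
  g = proj₁ (proj₂ hom)

  g-injective-in-edge : ∀ {e S S′ x y} → Edge A e → S ⊆ e → S′ ⊆ e → ∣ S ∣ ≡ k → ∣ S′ ∣ ≡ k →
    x ∈ S → y ∈ S′ → g S x ≡ g S′ y → x ≡ y
  g-injective-in-edge {e} {S} {S′} {x} {y} e∈A S⊆e S′⊆e ∣S∣≡k ∣S′∣≡k x∈S y∈S′ gₛx≡gₛ′y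
    with _ , _ , φ , (_ , φ-injective , _) , φ-extends ← proj₂ (proj₂ (proj₂ (proj₂ hom))) e e∈A =
    φ-injective (S⊆e x∈S) (S′⊆e y∈S′) (begin
      φ x     ≡⟨ φ-extends S S⊆e ∣S∣≡k x∈S ⟩
      g S x   ≡⟨ gₛx≡gₛ′y ⟩
      g S′ y  ≡⟨ sym (φ-extends S′ S′⊆e ∣S′∣≡k y∈S′) ⟩
      φ y     ∎)
    where open ≡-Reasoning

completeShadowHom⇒≤ : ∀ {m N} {B : RGraph (suc (suc m))} → suc (suc m) ≤ N →
  ShadowHom (suc m) (K (suc (suc m)) N) B → N ≤ n B
completeShadowHom⇒≤ {m} {N} {B} m+2≤N hom
  with T , refl ← subset-of-size {m} {N} (m+n≤o⇒n≤o 2 m+2≤N)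
  with x₀ , x₀∉T ← ∣p∣<n⇒∃x∉p T (m+n≤o⇒n≤o 1 m+2≤N) =
  injective⇒≤ {f = λ i → g (petal i) i} injective
  where
  open Sunflower T x₀∉T
  open ShadowHomProperties (K (suc (suc ∣ T ∣)) N) B hom
  injective : ∀ {i j} → g (petal i) i ≡ g (petal j) j → i ≡ j
  injective {i} {j} with e , e∈K , petalᵢ⊆e , petalⱼ⊆e ← petals-in-edge m+2≤N i j =
    g-injective-in-edge e∈K petalᵢ⊆e petalⱼ⊆e (∣petal∣ i) (∣petal∣ j) (i∈petal i) (i∈petal j)

proposition4p3 : (r s : ℕ) → 2 ≤ r → r ≤ s → ¬ ShadowHom (r ∸ 1) (K r (suc s)) (K r s)
proposition4p3 (suc (suc m)) s (s≤s (s≤s _)) r≤s hom =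
  1+n≰n (completeShadowHom⇒≤ {B = K (suc (suc m)) s} (m≤n⇒m≤1+n r≤s) hom)
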